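{- For every $\epsilon>0$ there is a connected graph $G$ of diameter two, with $n$ vertices and minimum degree $\delta$, such that $$\pi^*(G)>\frac{(4-\epsilon)\,n}{\delta+1}.$$
   Context: All graphs are finite and simple. A pebbling distribution $D$ on a graph $G$ is a function $D:V(G)\to\mathbb{Z}_{\ge 0}$ ($D(v)$ pebbles on $v$); its size is $|D|=\sum_v D(v)$. A pebbling move removes two pebbles from a vertex having at least two pebbles and places one pebble on an adjacent vertex. A vertex $v$ is $k$-reachable under $D$ if some sequence of pebbling moves, each legal at the moment it is made, results in at least $k$ pebbles on $v$; reachable means $1$-reachable. $D$ is solvable if every vertex is reachable. The optimal pebbling number $\pi^*(G)$ is the minimum size of a solvable distribution on $G$. -}

module Defs where

open import Data.Nat using (ℕ; zero; suc; _+_; _∸_; _≤_)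
open import Data.Fin using (Fin)
open import Data.Bool using (Bool; true; false; T; if_then_else_)
open import Data.List using (List; map; allFin)
open import Data.Nat.ListAction using (sum)
open import Data.Product using (Σ; _×_; ∃; _,_)
open import Relation.Nullary using (¬_)
open import Relation.Binary.PropositionalEquality using (_≡_; _≢_)
open import Relation.Binary.Construct.Closure.ReflexiveTransitive using (Star)
open import Data.Integer using (+_)
open import Data.Rational using (ℚ; _/_)

record Graph (n : ℕ) : Set where
  field
    Adj   : Fin n → Fin n → Bool
    sym   : ∀ u v → Adj u v ≡ Adj v u
    irrefl : ∀ v → Adj v v ≡ false
open Graph public

Adjacent : ∀ {n} → Graph n → Fin n → Fin n → Set
Adjacent G u v = T (Adj G u v)

degree : ∀ {n} → Graph n → Fin n → ℕ
degree {n} G v = sum (map (λ u → if Adj G v u then 1 else 0) (allFin n))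

MinDegree : ∀ {n} → Graph n → ℕ → Set
MinDegree {n} G δ = (∀ v → δ ≤ degree G v) × ∃ λ v → degree G v ≡ δ

-- WithinDist G k u v : there is a walk of length at most k from u to v,
-- i.e. dist(u,v) ≤ k.
data WithinDist {n : ℕ} (G : Graph n) : ℕ → Fin n → Fin n → Set where
  here : ∀ {k v} → WithinDist G k v v
  step : ∀ {k u w v} → Adjacent G u w → WithinDist G k w v → WithinDist G (suc k) u v

Connected : ∀ {n} → Graph n → Set
Connected {n} G = ∀ (u v : Fin n) → ∃ λ k → WithinDist G k u v

-- diameter of G equals d: all distances ≤ d, and some distance is exactly d
-- (i.e. some pair is not within distance d ∸ 1).  Used with d = 2.
HasDiameter : ∀ {n} → Graph n → ℕ → Set
HasDiameter {n} G d =
  (∀ (u v : Fin n) → WithinDist G d u v) ×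
  ∃ λ u → ∃ λ v → ¬ WithinDist G (d ∸ 1) u v

Distribution : ℕ → Set
Distribution n = Fin n → ℕ

size : ∀ {n} → Distribution n → ℕ
size {n} D = sum (map D (allFin n))

data Move {n : ℕ} (G : Graph n) (D : Distribution n) : Distribution n → Set where
  move : ∀ (u w : Fin n) (D' : Distribution n) →
         Adjacent G u w →
         2 ≤ D u →
         D' u ≡ D u ∸ 2 →
         D' w ≡ D w + 1 →
         (∀ x → x ≢ u → x ≢ w → D' x ≡ D x) →
         Move G D D'

Moves : ∀ {n} → Graph n → Distribution n → Distribution n → Set
Moves G = Star (Move G)

Reachable : ∀ {n} → Graph n → ℕ → Distribution n → Fin n → Set
Reachable {n} G k D v = ∃ λ (D' : Distribution n) → Moves G D D' × k ≤ D' v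

Solvable : ∀ {n} → Graph n → Distribution n → Set
Solvable G D = ∀ v → Reachable G 1 D v

IsOptimalPebblingNumber : ∀ {n} → Graph n → ℕ → Set
IsOptimalPebblingNumber {n} G k =
  (∃ λ (D : Distribution n) → Solvable G D × size D ≡ k) ×
  (∀ (D : Distribution n) → Solvable G D → k ≤ size D)

ℕtoℚ : ℕ → ℚ
ℕtoℚ m = (+ m) / 1

module Submission where

-- Given ε = (1 + p)/(1 + d) > 0, the witness is the complement of the rook's
-- graph on an m × m board, m = 3 + 8(1 + d): cells are adjacent when they share
-- neither a row nor a column.  It has n = m² vertices, is (m - 1)²-regular, has
-- diameter two, and π* = 4:
--  * upper bound (UpperBound): 2^k pebbles on u can put a pebble on any vertex
--    within distance k, so four pebbles on one vertex solve a diameter-two graph;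
--  * lower bound (LowerBound): in a graph on at least four vertices where any two
--    vertices have a common non-neighbour, three pebbles never suffice.  The
--    proof uses the potential with weight 4 at a target, 2 on its neighbours and
--    1 elsewhere, which no pebbling move increases (Potential).
-- The required (4 - ε)·n < 4·(δ + 1) clears denominators to an inequality of
-- natural numbers that holds because m > 8(1 + d) (Arithmetic).

-- the Graph field sym is hidden so that sym denotes symmetry of ≡
open import Defs hiding (sym)
open import Data.Nat using (ℕ; suc)
open import Data.Product using (Σ; _×_; ∃)

module FiniteSums where

  open import Data.Nat using (ℕ; zero; suc; _+_; _*_; _≤_)
  open import Data.Nat.Properties
    using (≤-refl; ≤-trans; ≤-reflexive; +-mono-≤; +-monoʳ-≤; m≤m+n; +-assoc; +-identityʳ; *-zeroʳ;
           +-0-commutativeMonoid)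
  open import Data.Fin using (Fin; zero; suc; _↑ˡ_; _↑ʳ_; combine; punchIn; punchOut)
  open import Data.Fin.Properties using (_≟_; punchInᵢ≢i; punchIn-punchOut; punchOut-injective)
  open import Data.Bool using (if_then_else_)
  open import Data.List using (map; allFin; tabulate)
  open import Data.List.Properties using (map-tabulate)
  import Data.Nat.ListAction as List
  open import Function using (_∘_; id)
  open import Relation.Nullary using (does)
  open import Relation.Nullary.Decidable using (dec-true; dec-false)
  open import Relation.Binary.PropositionalEquality
  open import Algebra.Properties.CommutativeMonoid.Sum +-0-commutativeMonoid public
    using (sum; sum-cong-≗; sum-remove; ∑-distrib-+)

  listSum-allFin : ∀ {n} (f : Fin n → ℕ) → List.sum (map f (allFin n)) ≡ sum f
  listSum-allFin {n} f = trans (cong List.sum (map-tabulate id f)) (listSum-tabulate f)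
    where
    listSum-tabulate : ∀ {n} (g : Fin n → ℕ) → List.sum (tabulate g) ≡ sum g
    listSum-tabulate {zero}  g = refl
    listSum-tabulate {suc n} g = cong (g zero +_) (listSum-tabulate (g ∘ suc))

  sum-mono : ∀ {n} {f g : Fin n → ℕ} → (∀ x → f x ≤ g x) → sum f ≤ sum g
  sum-mono {zero}  f≤g = ≤-refl
  sum-mono {suc n} f≤g = +-mono-≤ (f≤g zero) (sum-mono (f≤g ∘ suc))

  sum-const : ∀ n (c : ℕ) → sum {n} (λ _ → c) ≡ n * c
  sum-const zero    c = refl
  sum-const (suc n) c = cong (c +_) (sum-const n c)

  sum-except : ∀ {n} (f : Fin (suc n) → ℕ) i c → (∀ x → x ≢ i → f x ≡ c) →
               sum f ≡ f i + n * c
  sum-except {n} f i c off = begin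
    sum f                          ≡⟨ sum-remove f ⟩
    f i + sum (f ∘ punchIn i)      ≡⟨ cong (f i +_) (sum-cong-≗ (λ j → off _ (punchInᵢ≢i i j))) ⟩
    f i + sum {n} (λ _ → c)        ≡⟨ cong (f i +_) (sum-const n c) ⟩
    f i + n * c                    ∎
    where open ≡-Reasoning

  pull-out : ∀ {n} (f : Fin (suc n) → ℕ) i {a} → a ≤ sum (f ∘ punchIn i) → f i + a ≤ sum f
  pull-out f i a≤ = ≤-trans (+-monoʳ-≤ (f i) a≤) (≤-reflexive (sym (sum-remove f)))

  term≤sum : ∀ {n} (f : Fin n → ℕ) i → f i ≤ sum f
  term≤sum {suc n} f i = ≤-trans (m≤m+n (f i) _) (pull-out f i ≤-refl)

  punchIn-value : ∀ {n} (f : Fin (suc n) → ℕ) {i j} (i≢j : i ≢ j) →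
                  f j ≡ (f ∘ punchIn i) (punchOut i≢j)
  punchIn-value f i≢j = cong f (sym (punchIn-punchOut i≢j))

  pair≤sum : ∀ {n} (f : Fin n → ℕ) {i j} → i ≢ j → f i + f j ≤ sum f
  pair≤sum {suc n} f {i} i≢j =
    pull-out f i (≤-trans (≤-reflexive (punchIn-value f i≢j)) (term≤sum (f ∘ punchIn i) _))

  triple≤sum : ∀ {n} (f : Fin n → ℕ) {i j k} → i ≢ j → i ≢ k → j ≢ k →
               f i + (f j + f k) ≤ sum f
  triple≤sum {suc n} f {i} i≢j i≢k j≢k =
    pull-out f i (≤-trans (≤-reflexive (cong₂ _+_ (punchIn-value f i≢j) (punchIn-value f i≢k)))
                          (pair≤sum (f ∘ punchIn i) (j≢k ∘ punchOut-injective i≢j i≢k)))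

  sum-split : ∀ a {b} (f : Fin (a + b) → ℕ) →
              sum f ≡ sum {a} (f ∘ (_↑ˡ b)) + sum {b} (f ∘ (a ↑ʳ_))
  sum-split zero    f = refl
  sum-split (suc a) f = trans (cong (f zero +_) (sum-split a (f ∘ suc))) (sym (+-assoc (f zero) _ _))

  sum-combine : ∀ a {b} (f : Fin (a * b) → ℕ) →
                sum f ≡ sum {a} (λ i → sum {b} (λ j → f (combine i j)))
  sum-combine zero    f = refl
  sum-combine (suc a) {b} f =
    trans (sum-split b f) (cong (sum {b} (f ∘ (_↑ˡ (a * b))) +_) (sum-combine a (f ∘ (b ↑ʳ_))))

  single : ∀ {n} → Fin n → ℕ → Fin n → ℕ
  single i c x = if does (x ≟ i) then c else 0

  single-at : ∀ {n} (i : Fin n) c → single i c i ≡ c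
  single-at i c rewrite dec-true (i ≟ i) refl = refl

  single-off : ∀ {n} {i x : Fin n} c → x ≢ i → single i c x ≡ 0
  single-off {i = i} {x} c x≢i rewrite dec-false (x ≟ i) x≢i = refl

  sum-single : ∀ {n} (i : Fin n) c → sum (single i c) ≡ c
  sum-single {suc n} i c = begin
    sum (single i c)   ≡⟨ sum-except (single i c) i 0 (λ x → single-off c) ⟩
    single i c i + n * 0 ≡⟨ cong₂ _+_ (single-at i c) (*-zeroʳ n) ⟩
    c + 0              ≡⟨ +-identityʳ c ⟩
    c                  ∎
    where open ≡-Reasoning

module GraphBasics where

  open import Data.Bool using (T)
  open import Data.Sum using (_⊎_; inj₁; inj₂)
  open import Relation.Binary.PropositionalEquality

  adjacent-distinct : ∀ {n} (G : Graph n) {u w} → Adjacent G u w → u ≢ w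
  adjacent-distinct G {u} adj refl = subst T (irrefl G u) adj

  within-one : ∀ {n} {G : Graph n} {u v} → WithinDist G 1 u v → u ≡ v ⊎ Adjacent G u v
  within-one here              = inj₁ refl
  within-one (step adj here)   = inj₂ adj

-- Weight functions that at most double along edges give potentials that no
-- pebbling move can increase (a move spends two pebbles at u, worth 2·wt u,
-- to gain one at w, worth wt w).
module Potential where

  open FiniteSums
  open GraphBasics
  open import Data.Nat using (ℕ; _+_; _*_; _∸_; _≤_; z≤n; s≤s)
  open import Data.Nat.Properties
    using (≤-refl; ≤-trans; m≤m+n; +-monoʳ-≤; +-cancelʳ-≤; *-monoˡ-≤; +-identityʳ;
           *-identityˡ; *-distribʳ-+; m∸n+n≡m; ≤-reflexive; module ≤-Reasoning)
  open import Data.Fin using (Fin)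
  open import Data.Fin.Properties using (_≟_)
  open import Data.Bool using (true; false; T; if_then_else_)
  open import Data.Product using (_,_)
  open import Function using (_∘_)
  open import Relation.Nullary using (Dec; does; yes; no)
  open import Relation.Nullary.Decidable using (dec-true; dec-false)
  open import Relation.Binary.PropositionalEquality
  open import Relation.Binary.Construct.Closure.ReflexiveTransitive using (ε; _◅_)

  module WeightedPotential {n} (G : Graph n) (wt : Fin n → ℕ)
                           (doubling : ∀ {u w} → Adjacent G u w → wt w ≤ 2 * wt u) where

    potential : Distribution n → ℕ
    potential D = sum (λ x → D x * wt x)

    move-decreases : ∀ {D D'} → Move G D D' → potential D' ≤ potential D
    move-decreases {D} {D'} (move u w _ adj 2≤Du D'u D'w D'x) =
      +-cancelʳ-≤ (2 * wt u) _ _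
        (≤-trans (≤-reflexive balance-sum) (+-monoʳ-≤ (potential D) (doubling adj)))
      where
      open ≡-Reasoning
      u≢w : u ≢ w
      u≢w = adjacent-distinct G adj
      -- the move, vertex by vertex: weight lost at u on the left, weight gained at w on the right
      balance : ∀ x → Dec (x ≡ u) → Dec (x ≡ w) →
                D' x * wt x + single u (2 * wt u) x ≡ D x * wt x + single w (wt w) x
      balance _ (yes refl) _ = begin
        D' u * wt u + single u (2 * wt u) u  ≡⟨ cong₂ _+_ (cong (_* wt u) D'u) (single-at u _) ⟩
        (D u ∸ 2) * wt u + 2 * wt u          ≡⟨ *-distribʳ-+ (wt u) (D u ∸ 2) 2 ⟨
        (D u ∸ 2 + 2) * wt u                 ≡⟨ cong (_* wt u) (m∸n+n≡m 2≤Du) ⟩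
        D u * wt u                           ≡⟨ +-identityʳ _ ⟨
        D u * wt u + 0                       ≡⟨ cong (D u * wt u +_) (single-off _ u≢w) ⟨
        D u * wt u + single w (wt w) u       ∎
      balance _ (no _) (yes refl) = begin
        D' w * wt w + single u (2 * wt u) w  ≡⟨ cong₂ _+_ (cong (_* wt w) D'w) (single-off _ (u≢w ∘ sym)) ⟩
        (D w + 1) * wt w + 0                 ≡⟨ +-identityʳ _ ⟩
        (D w + 1) * wt w                     ≡⟨ *-distribʳ-+ (wt w) (D w) 1 ⟩
        D w * wt w + 1 * wt w                ≡⟨ cong (D w * wt w +_) (*-identityˡ (wt w)) ⟩
        D w * wt w + wt w                    ≡⟨ cong (D w * wt w +_) (single-at w _) ⟨
        D w * wt w + single w (wt w) w       ∎
      balance x (no x≢u) (no x≢w) =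
        cong₂ _+_ (cong (_* wt x) (D'x x x≢u x≢w)) (trans (single-off _ x≢u) (sym (single-off _ x≢w)))
      balance-sum : potential D' + 2 * wt u ≡ potential D + wt w
      balance-sum = begin
        potential D' + 2 * wt u
          ≡⟨ cong (potential D' +_) (sum-single u _) ⟨
        potential D' + sum (single u (2 * wt u))
          ≡⟨ ∑-distrib-+ (λ x → D' x * wt x) (single u (2 * wt u)) ⟨
        sum (λ x → D' x * wt x + single u (2 * wt u) x)
          ≡⟨ sum-cong-≗ (λ x → balance x (x ≟ u) (x ≟ w)) ⟩
        sum (λ x → D x * wt x + single w (wt w) x)
          ≡⟨ ∑-distrib-+ (λ x → D x * wt x) (single w (wt w)) ⟩
        potential D + sum (single w (wt w))
          ≡⟨ cong (potential D +_) (sum-single w _) ⟩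
        potential D + wt w
          ∎

    moves-decrease : ∀ {D D'} → Moves G D D' → potential D' ≤ potential D
    moves-decrease ε          = ≤-refl
    moves-decrease (m ◅ rest) = ≤-trans (moves-decrease rest) (move-decreases m)

  module TargetPotential {n} (G : Graph n) (z : Fin n) where

    weight : Fin n → ℕ
    weight x = if does (x ≟ z) then 4 else (if Adj G z x then 2 else 1)

    weight-target : weight z ≡ 4
    weight-target rewrite dec-true (z ≟ z) refl = refl

    weight-far : ∀ {x} → x ≢ z → Adj G z x ≡ false → weight x ≡ 1
    weight-far {x} x≢z far rewrite dec-false (x ≟ z) x≢z | far = refl

    weight≤4 : ∀ x → weight x ≤ 4
    weight≤4 x with does (x ≟ z) | Adj G z x
    ... | true  | _     = ≤-refl
    ... | false | true  = s≤s (s≤s z≤n)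
    ... | false | false = s≤s z≤n

    -- weights lie in {1, 2, 4}; a vertex of weight 1 is not adjacent to z, so its
    -- neighbours are not z and have weight at most 2
    weight-doubling : ∀ {u w} → Adjacent G u w → weight w ≤ 2 * weight u
    weight-doubling {u} {w} adj with does (u ≟ z) | Adj G z u in zu
    ... | true  | _     = ≤-trans (weight≤4 w) (m≤m+n 4 4)
    ... | false | true  = weight≤4 w
    ... | false | false = neighbour-weight≤2
      where
      w≢z : w ≢ z
      w≢z refl = subst T (trans (Graph.sym G u z) zu) adj
      neighbour-weight≤2 : weight w ≤ 2
      neighbour-weight≤2 rewrite dec-false (w ≟ z) w≢z with Adj G z w
      ... | true  = ≤-refl
      ... | false = s≤s z≤n

    open WeightedPotential G weight weight-doubling public

    reachable⇒potential≥4 : ∀ {D} → Reachable G 1 D z → 4 ≤ potential D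
    reachable⇒potential≥4 {D} (D' , moves , 1≤D'z) = begin
      4                   ≡⟨ *-identityˡ 4 ⟨
      1 * 4               ≤⟨ *-monoˡ-≤ 4 1≤D'z ⟩
      D' z * 4            ≡⟨ cong (D' z *_) weight-target ⟨
      D' z * weight z     ≤⟨ term≤sum (λ x → D' x * weight x) z ⟩
      potential D'        ≤⟨ moves-decrease moves ⟩
      potential D         ∎
      where open ≤-Reasoning

-- Three pebbles either sit one per
-- vertex (then nothing moves and some vertex stays empty), or include a pile
-- of two at u with the rest on one vertex w; then a common non-neighbour z of
-- u and w sees all pebbles at weight 1 and has target potential at most 3.
module LowerBound where

  open FiniteSums
  open Potential
  open import Data.Nat using (zero; suc; _*_; _≤_; _≤?_; s≤s; z≤n)
  open import Data.Nat.Properties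
    using (≤-trans; ≤-pred; ≤-reflexive; ≰⇒>; <-irrefl; +-mono-≤; *-identityʳ)
  open import Data.Fin using (Fin)
  open import Data.Fin.Properties using (_≟_; any?)
  open import Data.Bool using (false)
  open import Data.Product using (∃; _×_; _,_)
  open import Data.Sum using (_⊎_; inj₁; inj₂)
  open import Function using (_∘_)
  open import Relation.Nullary using (¬_; yes; no; contradiction; ¬?; _×-dec_)
  open import Relation.Binary.PropositionalEquality
  open import Relation.Binary.Construct.Closure.ReflexiveTransitive using (ε; _◅_)

  CommonNonNeighbours : ∀ {n} → Graph n → Set
  CommonNonNeighbours {n} G =
    ∀ (u w : Fin n) → ∃ λ z → z ≢ u × z ≢ w × Adj G z u ≡ false × Adj G z w ≡ false

  stuck-reachable : ∀ {n} {G : Graph n} {D v} → (∀ x → D x ≤ 1) → Reachable G 1 D v → 1 ≤ D v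
  stuck-reachable ≤1 (_ , ε , 1≤Dv) = 1≤Dv
  stuck-reachable ≤1 (_ , (move u _ _ _ 2≤Du _ _ _ ◅ _) , _) =
    contradiction (≤-trans 2≤Du (≤1 u)) λ { (s≤s ()) }

  no-pile⇒size≥n : ∀ {n} {G : Graph n} {D} → (∀ x → D x ≤ 1) → Solvable G D → n ≤ sum D
  no-pile⇒size≥n {n} {D = D} ≤1 solvable =
    subst (_≤ sum D) (trans (sum-const n 1) (*-identityʳ n))
          (sum-mono (stuck-reachable ≤1 ∘ solvable))

  small-support : ∀ {n} (D : Distribution n) {u} → sum D ≤ 3 → 2 ≤ D u →
                  ∃ λ w → ∀ x → 1 ≤ D x → x ≡ u ⊎ x ≡ w
  small-support D {u} ≤3 2≤Du with any? (λ x → ¬? (x ≟ u) ×-dec (1 ≤? D x))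
  ... | no nothing-else = u , only-u
    where
    only-u : ∀ x → 1 ≤ D x → x ≡ u ⊎ x ≡ u
    only-u x 1≤Dx with x ≟ u
    ... | yes x≡u = inj₁ x≡u
    ... | no x≢u  = contradiction (x , x≢u , 1≤Dx) nothing-else
  ... | yes (w , w≢u , 1≤Dw) = w , u-or-w
    where
    u-or-w : ∀ x → 1 ≤ D x → x ≡ u ⊎ x ≡ w
    u-or-w x 1≤Dx with x ≟ u | x ≟ w
    ... | yes x≡u | _       = inj₁ x≡u
    ... | no _    | yes x≡w = inj₂ x≡w
    ... | no x≢u  | no x≢w  = contradiction (≤-trans four≤ ≤3) (<-irrefl refl)
      where
      four≤ : 4 ≤ sum D
      four≤ = ≤-trans (+-mono-≤ 2≤Du (+-mono-≤ 1≤Dw 1≤Dx))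
                      (triple≤sum D (w≢u ∘ sym) (x≢u ∘ sym) (x≢w ∘ sym))

  unreachable-target : ∀ {n} (G : Graph n) (D : Distribution n) z → sum D ≤ 3 →
                       (∀ x → 1 ≤ D x → x ≢ z × Adj G z x ≡ false) → ¬ Reachable G 1 D z
  unreachable-target G D z ≤3 far reach =
    <-irrefl refl (≤-trans (reachable⇒potential≥4 reach) (≤-trans (sum-mono weighted≤) ≤3))
    where
    open TargetPotential G z
    weighted≤ : ∀ x → D x * weight x ≤ D x
    weighted≤ x with D x in Dx
    ... | zero  = z≤n
    ... | suc k with far x (subst (1 ≤_) (sym Dx) (s≤s z≤n))
    ...   | x≢z , not-adjacent rewrite weight-far x≢z not-adjacent = ≤-reflexive (*-identityʳ (suc k))

  pile⇒unsolvable : ∀ {n} (G : Graph n) → CommonNonNeighbours G → ∀ {D u} →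
                    sum D ≤ 3 → 2 ≤ D u → ¬ Solvable G D
  pile⇒unsolvable G common {D} {u} ≤3 2≤Du solvable
    with small-support D ≤3 2≤Du
  ... | w , support with common u w
  ...   | z , z≢u , z≢w , zu , zw = unreachable-target G D z ≤3 far (solvable z)
    where
    far : ∀ x → 1 ≤ D x → x ≢ z × Adj G z x ≡ false
    far x 1≤Dx with support x 1≤Dx
    ... | inj₁ refl = z≢u ∘ sym , zu
    ... | inj₂ refl = z≢w ∘ sym , zw

  solvable⇒size≥4 : ∀ {n} (G : Graph n) → 4 ≤ n → CommonNonNeighbours G →
                    ∀ D → Solvable G D → 4 ≤ size D
  solvable⇒size≥4 G 4≤n common D solvable rewrite listSum-allFin D with 4 ≤? sum D
  ... | yes 4≤size = 4≤size
  ... | no 4≰size with any? (λ x → 2 ≤? D x)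
  ...   | yes (u , 2≤Du) =
    contradiction solvable (pile⇒unsolvable G common (≤-pred (≰⇒> 4≰size)) 2≤Du)
  ...   | no no-pile =
    contradiction (≤-trans 4≤n (no-pile⇒size≥n {G = G} at-most-one solvable)) 4≰size
    where
    at-most-one : ∀ x → D x ≤ 1
    at-most-one x = ≤-pred (≰⇒> (λ 2≤Dx → no-pile (x , 2≤Dx)))

-- Upper bound: pebbles can be pushed along a walk, halving at each step, so
-- 2^k·j pebbles on u put j pebbles on any vertex within distance k.
module UpperBound where

  open FiniteSums
  open GraphBasics
  open import Data.Nat using (zero; suc; _+_; _*_; _^_; _∸_; _≤_)
  open import Data.Nat.Properties
    using (≤-trans; ≤-reflexive; +-identityʳ; +-assoc; *-assoc; *-suc; m≤m+n; m≤n+m; m≤n*m; m^n≢0;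
           ∸-monoˡ-≤)
  open import Data.Fin using (Fin)
  open import Data.Fin.Properties using (_≟_)
  open import Data.Bool using (if_then_else_)
  open import Data.Product using (∃; _×_; _,_)
  open import Function using (_∘_)
  open import Relation.Nullary using (does)
  open import Relation.Nullary.Decidable using (dec-true; dec-false)
  open import Relation.Binary.PropositionalEquality
  open import Relation.Binary.Construct.Closure.ReflexiveTransitive using (ε; _◅_; _◅◅_)

  after-move : ∀ {n} → Distribution n → Fin n → Fin n → Distribution n
  after-move D u w x = if does (x ≟ u) then D u ∸ 2 else (if does (x ≟ w) then D w + 1 else D x)

  module _ {n} (G : Graph n) {u w : Fin n} (adj : Adjacent G u w) where

    after-move-source : ∀ D → after-move D u w u ≡ D u ∸ 2
    after-move-source D rewrite dec-true (u ≟ u) refl = refl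

    after-move-target : ∀ D → after-move D u w w ≡ D w + 1
    after-move-target D
      rewrite dec-false (w ≟ u) (adjacent-distinct G adj ∘ sym) | dec-true (w ≟ w) refl = refl

    after-move-elsewhere : ∀ D x → x ≢ u → x ≢ w → after-move D u w x ≡ D x
    after-move-elsewhere D x x≢u x≢w rewrite dec-false (x ≟ u) x≢u | dec-false (x ≟ w) x≢w = refl

    pebbling-move : ∀ {D} → 2 ≤ D u → Move G D (after-move D u w)
    pebbling-move {D} 2≤Du =
      move u w _ adj 2≤Du (after-move-source D) (after-move-target D) (after-move-elsewhere D)

    transfer : ∀ t {D} → 2 * t ≤ D u → ∃ λ D' → Moves G D D' × D w + t ≤ D' w
    transfer zero    {D} _ = D , ε , ≤-reflexive (+-identityʳ (D w))
    transfer (suc t) {D} 2t+2≤Du =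
      let D' , moves , ≤D'w = transfer t {after-move D u w} remaining
      in  D' , pebbling-move 2≤Du ◅ moves , ≤-trans (≤-reflexive gained) ≤D'w
      where
      2+2t≤Du : 2 + 2 * t ≤ D u
      2+2t≤Du = subst (_≤ D u) (*-suc 2 t) 2t+2≤Du
      2≤Du : 2 ≤ D u
      2≤Du = ≤-trans (m≤m+n 2 (2 * t)) 2+2t≤Du
      remaining : 2 * t ≤ after-move D u w u
      remaining = subst (2 * t ≤_) (sym (after-move-source D)) (∸-monoˡ-≤ 2 2+2t≤Du)
      gained : D w + suc t ≡ after-move D u w w + t
      gained = trans (sym (+-assoc (D w) 1 t)) (cong (_+ t) (sym (after-move-target D)))

  -- 2^k·j pebbles on u give j pebbles on any v within distance k: transfer
  -- 2^(k-1)·j pebbles to the first vertex of the walk and recurse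
  reach-within : ∀ {n} {G : Graph n} {k u v} → WithinDist G k u v →
                 ∀ j {D} → 2 ^ k * j ≤ D u → Reachable G j D v
  reach-within {k = k} here j {D} ≤Du = D , ε , ≤-trans (m≤n*m j (2 ^ k) {{m^n≢0 2 k}}) ≤Du
  reach-within {G = G} (step {k} {u} {w} adj rest) j {D} ≤Du =
    let D₁ , moves₁ , ≤D₁w = transfer G adj (2 ^ k * j) (subst (_≤ D u) (*-assoc 2 (2 ^ k) j) ≤Du)
        D₂ , moves₂ , j≤D₂v = reach-within rest j (≤-trans (m≤n+m _ (D w)) ≤D₁w)
    in  D₂ , moves₁ ◅◅ moves₂ , j≤D₂v

  diameter-two⇒solvable : ∀ {n} (G : Graph n) → (∀ u v → WithinDist G 2 u v) →
                          ∀ v₀ → Solvable G (single v₀ 4)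
  diameter-two⇒solvable G within v₀ v =
    reach-within (within v₀ v) 1 (≤-reflexive (sym (single-at v₀ 4)))

  size-single : ∀ {n} (v₀ : Fin n) c → size (single v₀ c) ≡ c
  size-single v₀ c = trans (listSum-allFin (single v₀ c)) (sum-single v₀ c)

-- It has n = m² vertices, is (m-1)²-regular, has diameter two, and any two
-- cells have a common non-neighbour, so π* = 4 while n/(δ+1) → 1.
module RookComplement (k : ℕ) where

  open FiniteSums
  open GraphBasics
  open LowerBound using (CommonNonNeighbours)
  open import Data.Nat using (zero; suc; _+_; _*_; _≤_; z≤n; s≤s)
  open import Data.Nat.Properties using (≤-trans; m≤m+n; *-mono-≤; *-zeroʳ; *-identityʳ)
  open import Data.Fin using (Fin; zero; suc; combine; quotient; remainder)
  open import Data.Fin.Properties using (_≟_; remQuot-combine; 0≢1+n)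
  open import Data.Bool using (false; T; if_then_else_)
  open import Data.Product using (∃; _×_; _,_; proj₁; proj₂)
  open import Data.Sum using (inj₁; inj₂)
  open import Function using (_∘_; mk⇔)
  open import Relation.Nullary using (Dec; ¬_; does; yes; no; ¬?; _×-dec_)
  open import Relation.Nullary.Decidable using (dec-true; dec-false; does-⇔)
  open import Data.Unit using (tt)
  open import Relation.Binary.PropositionalEquality

  m N : ℕ
  m = 3 + k
  N = m * m

  cell : Fin m → Fin m → Fin N
  cell = combine

  row col : Fin N → Fin m
  row = quotient {m} m
  col = remainder {m} m

  row-cell : ∀ (i j : Fin m) → row (cell i j) ≡ i
  row-cell i j = cong proj₁ (remQuot-combine i j)

  col-cell : ∀ (i j : Fin m) → col (cell i j) ≡ j
  col-cell i j = cong proj₂ (remQuot-combine i j)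

  NonAttacking : Fin N → Fin N → Set
  NonAttacking u v = row u ≢ row v × col u ≢ col v

  nonAttacking? : ∀ u v → Dec (NonAttacking u v)
  nonAttacking? u v = ¬? (row u ≟ row v) ×-dec ¬? (col u ≟ col v)

  nonAttacking-sym : ∀ u v → NonAttacking u v → NonAttacking v u
  nonAttacking-sym u v (r≢ , c≢) = r≢ ∘ sym , c≢ ∘ sym

  graph : Graph N
  graph = record
    { Adj    = λ u v → does (nonAttacking? u v)
    ; sym    = λ u v → does-⇔ (mk⇔ (nonAttacking-sym u v) (nonAttacking-sym v u))
                                (nonAttacking? u v) (nonAttacking? v u)
    ; irrefl = λ v → dec-false (nonAttacking? v v) (λ (r≢ , _) → r≢ refl)
    }

  nonAttacking⇒adjacent : ∀ u v → NonAttacking u v → Adjacent graph u v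
  nonAttacking⇒adjacent u v p = subst T (sym (dec-true (nonAttacking? u v) p)) tt

  same-row⇒nonadjacent : ∀ u v → row u ≡ row v → Adj graph u v ≡ false
  same-row⇒nonadjacent u v r≡ = dec-false (nonAttacking? u v) (λ (r≢ , _) → r≢ r≡)

  same-col⇒nonadjacent : ∀ u v → col u ≡ col v → Adj graph u v ≡ false
  same-col⇒nonadjacent u v c≡ = dec-false (nonAttacking? u v) (λ (_ , c≢) → c≢ c≡)

  nonAttacking-cell : ∀ u r c → r ≢ row u → c ≢ col u → NonAttacking u (cell r c)
  nonAttacking-cell u r c r≢ c≢ =
    (λ e → r≢ (sym (trans e (row-cell r c)))) , (λ e → c≢ (sym (trans e (col-cell r c))))

  third : (a b : Fin m) → ∃ λ c → c ≢ a × c ≢ b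
  third zero          zero          = suc zero , (λ ()) , (λ ())
  third zero          (suc zero)    = suc (suc zero) , (λ ()) , (λ ())
  third zero          (suc (suc _)) = suc zero , (λ ()) , (λ ())
  third (suc zero)    zero          = suc (suc zero) , (λ ()) , (λ ())
  third (suc zero)    (suc _)       = zero , (λ ()) , (λ ())
  third (suc (suc _)) zero          = suc zero , (λ ()) , (λ ())
  third (suc (suc _)) (suc _)       = zero , (λ ()) , (λ ())

  -- a cell off the rows and columns of u and v is adjacent to both: diameter ≤ 2
  common-neighbour : ∀ u v → ∃ λ y → Adjacent graph u y × Adjacent graph y v
  common-neighbour u v with third (row u) (row v) | third (col u) (col v)
  ... | r , r≢u , r≢v | c , c≢u , c≢v =
    y , nonAttacking⇒adjacent u y (nonAttacking-cell u r c r≢u c≢u)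
      , nonAttacking⇒adjacent y v (nonAttacking-sym v y (nonAttacking-cell v r c r≢v c≢v))
    where y = cell r c

  within-two : ∀ u v → WithinDist graph 2 u v
  within-two u v with common-neighbour u v
  ... | y , u-y , y-v = step {w = y} u-y (step {w = v} y-v here)

  -- two cells in the same row are at distance exactly two
  corner beside : Fin N
  corner = cell zero zero
  beside = cell zero (suc zero)

  not-within-one : ¬ WithinDist graph 1 corner beside
  not-within-one near with within-one near
  ... | inj₁ same =
    0≢1+n (trans (sym (col-cell zero zero)) (trans (cong col same) (col-cell zero (suc zero))))
  ... | inj₂ adj  = subst T (same-row⇒nonadjacent corner beside same-row) adj
    where same-row = trans (row-cell zero zero) (sym (row-cell zero (suc zero)))

  row-differs : ∀ {y x} → row y ≢ row x → y ≢ x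
  row-differs r≢ = r≢ ∘ cong row

  col-differs : ∀ {y x} → col y ≢ col x → y ≢ x
  col-differs c≢ = c≢ ∘ cong col

  -- any two cells u, w have a common non-neighbour: a third cell of their
  -- common row or column, or else the cell in u's row and w's column
  common-non-neighbours : CommonNonNeighbours graph
  common-non-neighbours u w with row u ≟ row w | col u ≟ col w
  ... | yes same-row | _ =
    let c , c≢u , c≢w = third (col u) (col w)
        z = cell (row u) c
    in  z , col-differs (subst (_≢ col u) (sym (col-cell (row u) c)) c≢u)
          , col-differs (subst (_≢ col w) (sym (col-cell (row u) c)) c≢w)
          , same-row⇒nonadjacent z u (row-cell (row u) c)
          , same-row⇒nonadjacent z w (trans (row-cell (row u) c) same-row)
  ... | no _ | yes same-col =
    let r , r≢u , r≢w = third (row u) (row w)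
        z = cell r (col u)
    in  z , row-differs (subst (_≢ row u) (sym (row-cell r (col u))) r≢u)
          , row-differs (subst (_≢ row w) (sym (row-cell r (col u))) r≢w)
          , same-col⇒nonadjacent z u (col-cell r (col u))
          , same-col⇒nonadjacent z w (trans (col-cell r (col u)) same-col)
  ... | no rows-differ | no cols-differ =
    let z = cell (row u) (col w)
    in  z , col-differs (subst (_≢ col u) (sym (col-cell (row u) (col w))) (cols-differ ∘ sym))
          , row-differs (subst (_≢ row w) (sym (row-cell (row u) (col w))) rows-differ)
          , same-row⇒nonadjacent z u (row-cell (row u) (col w))
          , same-col⇒nonadjacent z w (col-cell (row u) (col w))

  -- Every cell attacks the 2 + k other cells of its row and of its column,
  -- so it is adjacent to the remaining (2 + k)² cells.
  δ : ℕ
  δ = (2 + k) * (2 + k)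

  adjacency : Fin N → Fin N → ℕ
  adjacency v u = if Adj graph v u then 1 else 0

  adjacency-row : ∀ v j → adjacency v (cell (row v) j) ≡ 0
  adjacency-row v j =
    cong (λ b → if b then 1 else 0) (same-row⇒nonadjacent v (cell (row v) j) (sym (row-cell (row v) j)))

  adjacency-col : ∀ v i → adjacency v (cell i (col v)) ≡ 0
  adjacency-col v i =
    cong (λ b → if b then 1 else 0) (same-col⇒nonadjacent v (cell i (col v)) (sym (col-cell i (col v))))

  adjacency-elsewhere : ∀ v i j → i ≢ row v → j ≢ col v → adjacency v (cell i j) ≡ 1
  adjacency-elsewhere v i j i≢ j≢ =
    cong (λ b → if b then 1 else 0)
         (dec-true (nonAttacking? v (cell i j)) (nonAttacking-cell v i j i≢ j≢))

  -- summing the adjacency row by row: the own row contributes 0, every other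
  -- row 2 + k (all cells but the one in v's column)
  regular : ∀ v → degree graph v ≡ δ
  regular v = begin
    degree graph v                                  ≡⟨ listSum-allFin (adjacency v) ⟩
    sum (adjacency v)                               ≡⟨ sum-combine m {m} (adjacency v) ⟩
    sum (λ i → row-sum i)                           ≡⟨ sum-except row-sum (row v) (2 + k) other-row ⟩
    row-sum (row v) + δ                             ≡⟨ cong (_+ δ) own-row ⟩
    δ                                               ∎
    where
    open ≡-Reasoning
    row-sum : Fin m → ℕ
    row-sum i = sum (λ j → adjacency v (cell i j))
    own-row : row-sum (row v) ≡ 0
    own-row = trans (sum-cong-≗ {m} (adjacency-row v)) (trans (sum-const m 0) (*-zeroʳ m))
    other-row : ∀ i → i ≢ row v → row-sum i ≡ 2 + k
    other-row i i≢ = begin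
      row-sum i
        ≡⟨ sum-except (λ j → adjacency v (cell i j)) (col v) 1 (λ j → adjacency-elsewhere v i j i≢) ⟩
      adjacency v (cell i (col v)) + (2 + k) * 1
        ≡⟨ cong₂ _+_ (adjacency-col v i) (*-identityʳ (2 + k)) ⟩
      2 + k
        ∎

  four≤N : 4 ≤ N
  four≤N = ≤-trans (s≤s (s≤s (s≤s (s≤s z≤n)))) (*-mono-≤ (m≤m+n 3 k) (m≤m+n 3 k))

-- The final inequality (4 - ε)·n < 4·(δ + 1), first reduced to natural numbers
-- by clearing the denominator of ε = (1 + p)/(1 + d), then verified for a
-- board of side m = 3 + 8(1 + d), where εn ≥ m²/(1 + d) = 8m exceeds the gap
-- 4n - 4(δ + 1) = 8(m - 1).
module Arithmetic where

  open import Data.Nat as ℕ using (suc; _+_; _*_)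
  import Data.Nat.Properties as ℕ
  import Data.Nat.Tactic.RingSolver as ℕ-Solver
  open import Data.Integer as ℤ using (ℤ; +_; +[1+_])
  import Data.Integer.Properties as ℤ
  import Data.Integer.Tactic.RingSolver as ℤ-Solver
  import Data.Rational as ℚ
  import Data.Rational.Properties as ℚ
  open import Data.Rational.Unnormalised as ℚᵘ using (ℚᵘ; mkℚᵘ; *<*)
  import Data.Rational.Unnormalised.Properties as ℚᵘ
  open import Relation.Binary.PropositionalEquality

  +-cancelʳ-<ℤ : ∀ (x y b : ℤ) → x ℤ.+ b ℤ.< y ℤ.+ b → x ℤ.< y
  +-cancelʳ-<ℤ x y b lt = subst₂ ℤ._<_ (drop x) (drop y) (ℤ.+-monoˡ-< (ℤ.- b) lt)
    where
    drop : ∀ z → z ℤ.+ b ℤ.+ ℤ.- b ≡ z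
    drop z = trans (ℤ.+-assoc z b (ℤ.- b))
                   (trans (cong (λ w → z ℤ.+ w) (ℤ.+-inverseʳ b)) (ℤ.+-identityʳ z))

  -- the numerator of (4 - b/a)·N, plus b·N, is 4·a·N
  numerator-identity : ∀ (b a N : ℤ) →
    (+ 4 ℤ.* a ℤ.+ ℤ.- b ℤ.* + 1) ℤ.* N ℤ.* + 1 ℤ.+ b ℤ.* N ≡ + 4 ℤ.* a ℤ.* N
  numerator-identity = ℤ-Solver.solve-∀

  pos-*₃ : ∀ a b c → + a ℤ.* + b ℤ.* + c ≡ + (a * b * c)
  pos-*₃ a b c = trans (cong (ℤ._* + c) (sym (ℤ.pos-* a b))) (sym (ℤ.pos-* (a * b) c))

  ℕtoℚᵘ : ∀ x → ℚ.toℚᵘ (ℕtoℚ x) ℚᵘ.≃ mkℚᵘ (+ x) 0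
  ℕtoℚᵘ x = ℚ.toℚᵘ-fromℚᵘ (mkℚᵘ (+ x) 0)

  -- (4 - ε)·N < 4·S for ε = (1 + p)/(1 + d), compared via unnormalised
  -- rationals by cross-multiplication: 4(1 + d)N < 4S(1 + d) + (1 + p)N suffices
  cross-multiply : ∀ ε p d → ℚ.toℚᵘ ε ≡ mkℚᵘ +[1+ p ] d → ∀ N S →
                   4 * suc d * N ℕ.< 4 * S * suc d + suc p * N →
                   (ℕtoℚ 4 ℚ.- ε) ℚ.* ℕtoℚ N ℚ.< ℕtoℚ 4 ℚ.* ℕtoℚ S
  cross-multiply ε p d ε≡ N S lt =
    ℚ.toℚᵘ-cancel-< (ℚᵘ.<-respʳ-≃ (ℚᵘ.≃-sym rhs) (ℚᵘ.<-respˡ-≃ (ℚᵘ.≃-sym lhs) cleared))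
    where
    L R : ℚᵘ
    L = (mkℚᵘ (+ 4) 0 ℚᵘ.- mkℚᵘ +[1+ p ] d) ℚᵘ.* mkℚᵘ (+ N) 0
    R = mkℚᵘ (+ 4) 0 ℚᵘ.* mkℚᵘ (+ S) 0
    -ε : ℚ.toℚᵘ (ℚ.- ε) ℚᵘ.≃ ℚᵘ.- mkℚᵘ +[1+ p ] d
    -ε = ℚᵘ.≃-trans (ℚ.toℚᵘ-homo‿- ε) (ℚᵘ.-‿cong (ℚᵘ.≃-reflexive ε≡))
    lhs : ℚ.toℚᵘ ((ℕtoℚ 4 ℚ.- ε) ℚ.* ℕtoℚ N) ℚᵘ.≃ L
    lhs = ℚᵘ.≃-trans (ℚ.toℚᵘ-homo-* (ℕtoℚ 4 ℚ.- ε) (ℕtoℚ N))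
            (ℚᵘ.*-cong (ℚᵘ.≃-trans (ℚ.toℚᵘ-homo-+ (ℕtoℚ 4) (ℚ.- ε)) (ℚᵘ.+-cong (ℕtoℚᵘ 4) -ε))
                       (ℕtoℚᵘ N))
    rhs : ℚ.toℚᵘ (ℕtoℚ 4 ℚ.* ℕtoℚ S) ℚᵘ.≃ R
    rhs = ℚᵘ.≃-trans (ℚ.toℚᵘ-homo-* (ℕtoℚ 4) (ℕtoℚ S)) (ℚᵘ.*-cong (ℕtoℚᵘ 4) (ℕtoℚᵘ S))
    denominator : ℚᵘ.↧ L ≡ + suc d
    denominator = cong (λ x → + suc x) (trans (ℕ.*-identityʳ _) (ℕ.+-identityʳ d))
    cleared : L ℚᵘ.< R
    cleared = *<* (+-cancelʳ-<ℤ _ _ (+ suc p ℤ.* + N)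
                    (subst₂ ℤ._<_ (sym left) (sym right) (ℤ.+<+ lt)))
      where
      left : ℚᵘ.↥ L ℤ.* ℚᵘ.↧ R ℤ.+ + suc p ℤ.* + N ≡ + (4 * suc d * N)
      left = trans (numerator-identity (+ suc p) (+ suc d) (+ N)) (pos-*₃ 4 (suc d) N)
      right : ℚᵘ.↥ R ℤ.* ℚᵘ.↧ L ℤ.+ + suc p ℤ.* + N ≡ + (4 * S * suc d + suc p * N)
      right = begin
        + 4 ℤ.* + S ℤ.* ℚᵘ.↧ L ℤ.+ + suc p ℤ.* + N
          ≡⟨ cong (λ x → + 4 ℤ.* + S ℤ.* x ℤ.+ + suc p ℤ.* + N) denominator ⟩
        + 4 ℤ.* + S ℤ.* + suc d ℤ.+ + suc p ℤ.* + N
          ≡⟨ cong₂ ℤ._+_ (pos-*₃ 4 S (suc d)) (sym (ℤ.pos-* (suc p) N)) ⟩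
        + (4 * S * suc d) ℤ.+ + (suc p * N)
          ≡⟨ sym (ℤ.pos-+ (4 * S * suc d) (suc p * N)) ⟩
        + (4 * S * suc d + suc p * N)
          ∎
        where open ≡-Reasoning

  board-identity : ∀ a → 4 * a * ((3 + 8 * a) * (3 + 8 * a)) ≡
                         4 * (1 + (2 + 8 * a) * (2 + 8 * a)) * a + 8 * a * (2 + 8 * a)
  board-identity = ℕ-Solver.solve-∀

  square-gap : ∀ k → (3 + k) * (3 + k) ≡ k * (2 + k) + (1 + (4 * k + 8))
  square-gap = ℕ-Solver.solve-∀

  -- the cleared inequality for N = m² and S = 1 + (m - 1)²: the gap 8a(m - 1)
  -- is below m² ≤ (1 + p)m² because 8a < m
  board-inequality : ∀ p a → let m = 3 + 8 * a in
    4 * a * (m * m) ℕ.< 4 * suc ((2 + 8 * a) * (2 + 8 * a)) * a + suc p * (m * m)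
  board-inequality p a = begin-strict
    4 * a * (m * m)                      ≡⟨ board-identity a ⟩
    4 * S * a + k * (2 + k)              <⟨ ℕ.+-monoʳ-< (4 * S * a) gap<square ⟩
    4 * S * a + m * m                    ≤⟨ ℕ.+-monoʳ-≤ (4 * S * a) (ℕ.m≤n*m (m * m) (suc p)) ⟩
    4 * S * a + suc p * (m * m)          ∎
    where
    open ℕ.≤-Reasoning
    k = 8 * a
    m = 3 + k
    S = suc ((2 + k) * (2 + k))
    gap<square : k * (2 + k) ℕ.< m * m
    gap<square = subst (k * (2 + k) ℕ.<_) (sym (square-gap k)) (ℕ.m<m+n _ ℕ.z<s)

open FiniteSums using (single)
open LowerBound using (solvable⇒size≥4)
open UpperBound using (diameter-two⇒solvable; size-single)
open Arithmetic using (cross-multiply; board-inequality)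
import Data.Nat as ℕ
open import Data.Nat.Properties using (≤-reflexive)
open import Data.Integer using (+0; +[1+_]; -[1+_])
open import Data.Rational using (ℚ; Positive; _<_; _*_; _-_; mkℚ)
open import Data.Product using (_,_)
open import Relation.Binary.PropositionalEquality using (refl; sym)

theorem1 : ∀ (ε : ℚ) → Positive ε →
    ∃ λ (n : ℕ) → Σ (Graph n) λ G → ∃ λ (δ : ℕ) → ∃ λ (p : ℕ) →
      Connected G × HasDiameter G 2 × MinDegree G δ ×
      IsOptimalPebblingNumber G p ×
      ((ℕtoℚ 4 - ε) * ℕtoℚ n < ℕtoℚ p * ℕtoℚ (suc δ))
theorem1 (mkℚ +0       _ _) ()
theorem1 (mkℚ -[1+ _ ] _ _) ()
theorem1 ε@(mkℚ +[1+ p ] d _) _ =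
  N , graph , δ , 4 ,
  (λ u v → 2 , within-two u v) ,
  (within-two , corner , beside , not-within-one) ,
  ((λ v → ≤-reflexive (sym (regular v))) , corner , regular corner) ,
  ((single corner 4 , diameter-two⇒solvable graph within-two corner , size-single corner 4) ,
   solvable⇒size≥4 graph four≤N common-non-neighbours) ,
  cross-multiply ε p d refl N (suc δ) (board-inequality p (suc d))
  where open RookComplement (8 ℕ.* suc d)
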